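{- Let $F$ be a periodic fabric of order greater than $4$ whose strands are coloured by thin striping so that the colouring is perfect, and suppose the side-preserving subgroup $H_1$ of the symmetry group of $F$ is generated by side-preserving glide-reflections and is transitive on the strands. Then the pattern of the coloured fabric, regarded as a design, is the design of a prefabric $P$ with the following properties. If $\gamma$ is a side-preserving glide-reflection symmetry of $F$ whose axis either passes through irredundant cells and has glide an even multiple of $\delta$, or passes through redundant cells and has glide an odd multiple of $\delta$, then $\gamma$ is a side-preserving glide-reflection symmetry of $P$. If $\gamma$ is a side-preserving glide-reflection symmetry of $F$ whose axis either passes through redundant cells and has glide an even multiple of $\delta$, or passes through irredundant cells and has glide an odd multiple of $\delta$, then $\gamma$ (combined with side reversal) is a side-reversing glide-reflection symmetry of $P$.
   Context: A prefabric consists of two layers of parallel strands of unit width in a plane $E$: warps (vertical) and wefts (horizontal); each warp crosses each weft in a unit square cell, in which one of the two strands is specified uppermost. Prefabrics are periodic (invariant under two independent translations). A fabric is a prefabric that does not fall apart, where a prefabric falls apart if some nonempty proper subset $S$ of strands is uppermost at every crossing of a strand of $S$ with a strand not in $S$. The design of a prefabric is the array of cells, viewed from the obverse side, with a cell dark if the warp is uppermost and pale if the weft is uppermost; any dark/pale array of cells is the design of a unique prefabric. A symmetry is an isometry $\sigma$ of the plane preserving the cell grid, either side-preserving or side-reversing (combined with reflection $\tau$ in $E$), such that for every cell $c$ the design colour of $\sigma(c)$ equals that of $c$, complemented once if $\sigma$ interchanges vertical and horizontal directions and once more if $\sigma$ is side-reversing. The side-preserving symmetries form the subgroup $H_1$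 of the symmetry group $G_1$. The order of an isonemal prefabric (one whose $G_1$ is transitive on strands) is the period of the over/under sequence along a strand. Thin striping colours warps alternately dark and pale and wefts alternately dark and pale; the pattern shows in each cell the colour of the uppermost strand. A cell is redundant if its warp and weft have the same colour and irredundant otherwise (these form a checkerboard). The colouring is perfect if every symmetry either preserves the colours of all strands or interchanges them. $\delta=\sqrt2$ denotes the length of a cell diagonal. The glide-reflection axes considered are in mirror position, i.e. along diagonal lines through cell centres and corners; all cells whose centres lie on such an axis are either all redundant or all irredundant, and the axis is said to pass through redundant or irredundant cells accordingly. -}

module Defs where

open import Data.Bool using (Bool; true; false; not; _xor_; if_then_else_)
open import Data.Integer using (ℤ; +_; _+_; _-_; _*_; ∣_∣)
open import Data.Nat using (ℕ; _≡ᵇ_; _%_; _<_; _≤_)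
open import Data.Product using (_×_; _,_; Σ; ∃; ∃-syntax)
open import Data.Sum using (_⊎_)
open import Data.List using (List; []; _∷_)
open import Data.List.Relation.Unary.All using (All)
open import Relation.Binary.PropositionalEquality using (_≡_; _≢_)
open import Relation.Nullary using (¬_)

-- A cell is indexed by (i , j): i = column (warp index), j = row (weft
-- index).  The cell (i , j) is the unit square [i,i+1] × [j,j+1].
Cell : Set
Cell = ℤ × ℤ

-- A design: true = dark (warp uppermost), false = pale (weft uppermost).
-- Every design is the design of a unique prefabric, so a prefabric is
-- identified with its design.
Design : Set
Design = ℤ → ℤ → Bool

at : Design → Cell → Bool
at D (i , j) = D i j

data Strand : Set where
  warp : ℤ → Strand
  weft : ℤ → Strand

Periodic : Design → Set
Periodic D = ∃[ a ] ∃[ b ] ∃[ c ] ∃[ d ]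
  ((a * d - b * c) ≢ + 0) ×
  (∀ i j → D (i + a) (j + b) ≡ D i j) ×
  (∀ i j → D (i + c) (j + d) ≡ D i j)

FallsApartVia : Design → (Strand → Bool) → Set
FallsApartVia D S =
  (∃[ s ] S s ≡ true) × (∃[ s ] S s ≡ false) ×
  (∀ i j → (S (warp i) ≡ true → S (weft j) ≡ false → D i j ≡ true)
         × (S (weft j) ≡ true → S (warp i) ≡ false → D i j ≡ false))

FallsApart : Design → Set
FallsApart D = ∃[ S ] FallsApartVia D S

IsFabric : Design → Set
IsFabric D = ¬ FallsApart D

-- Point action: (x , y) ↦ swap-if-swp, then negate the x- (resp. y-)
-- coordinate if negx (resp. negy), then translate by (tx , ty) ∈ ℤ².
-- These are exactly the isometries of E preserving the grid of lines.
record Isometry : Set where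
  constructor iso
  field
    swp  : Bool
    negx : Bool
    negy : Bool
    tx   : ℤ
    ty   : ℤ

coordAct : Bool → ℤ → ℤ → ℤ
coordAct false t u = u + t
coordAct true  t u = (t - + 1) - u

cellAct : Isometry → Cell → Cell
cellAct (iso false nx ny tx ty) (i , j) = coordAct nx tx i , coordAct ny ty j
cellAct (iso true  nx ny tx ty) (i , j) = coordAct nx tx j , coordAct ny ty i

strandAct : Isometry → Strand → Strand
strandAct (iso false nx ny tx ty) (warp i) = warp (coordAct nx tx i)
strandAct (iso false nx ny tx ty) (weft j) = weft (coordAct ny ty j)
strandAct (iso true  nx ny tx ty) (warp i) = weft (coordAct ny ty i)
strandAct (iso true  nx ny tx ty) (weft j) = warp (coordAct nx tx j)

Swaps : Isometry → Bool
Swaps σ = Isometry.swp σ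

OrientationReversing : Isometry → Set
OrientationReversing (iso s nx ny _ _) = (s xor nx xor ny) ≡ true

-- glide-reflection: orientation-reversing and not a reflection
-- (a reflection is exactly an orientation-reversing involution)
IsGlideReflection : Isometry → Set
IsGlideReflection σ =
  OrientationReversing σ × (∃[ c ] cellAct σ (cellAct σ c) ≢ c)

-- σ, side-preserving (rev = false) or side-reversing (rev = true, i.e.
-- combined with τ), is a symmetry of the prefabric with design D
IsSymmetry : Design → Isometry → (rev : Bool) → Set
IsSymmetry D σ rev =
  ∀ c → at D (cellAct σ c) ≡ (at D c xor Swaps σ) xor rev

InH1 : Design → Isometry → Set
InH1 D σ = IsSymmetry D σ false

composeAll : List Isometry → Cell → Cell
composeAll []       c = c
composeAll (σ ∷ σs) c = cellAct σ (composeAll σs c)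

-- H₁ is generated by its side-preserving glide-reflections
-- (inverses of such are again such, so finite products suffice)
H1GeneratedByGlides : Design → Set
H1GeneratedByGlides D =
  ∀ σ → InH1 D σ →
    ∃[ gs ] (All (λ γ → IsGlideReflection γ × InH1 D γ) gs ×
             (∀ c → cellAct σ c ≡ composeAll gs c))

H1Transitive : Design → Set
H1Transitive D = ∀ s t → ∃[ σ ] (InH1 D σ × strandAct σ s ≡ t)

-- order > 4: period of the over/under sequence along a strand
-- (warp 0; all strands have the same period as H₁ is transitive)
OrderGreaterThan4 : Design → Set
OrderGreaterThan4 D =
  ∀ (p : ℕ) → 0 < p → p ≤ 4 → ¬ (∀ j → D (+ 0) (j + + p) ≡ D (+ 0) j)

parity : ℤ → Bool
parity i = (∣ i ∣ % 2) ≡ᵇ 1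

thinStriping : Bool → Bool → Strand → Bool
thinStriping a b (warp i) = parity i xor a
thinStriping a b (weft j) = parity j xor b

-- the pattern: each cell shows the colour of its uppermost strand,
-- regarded as a design (dark cell = dark)
pattern' : Design → (Strand → Bool) → Design
pattern' D col i j = if D i j then col (warp i) else col (weft j)

Redundant : (Strand → Bool) → Cell → Set
Redundant col (i , j) = col (warp i) ≡ col (weft j)

Perfect : Design → (Strand → Bool) → Set
Perfect D col =
  ∀ σ rev → IsSymmetry D σ rev →
    (∀ s → col (strandAct σ s) ≡ col s) ⊎
    (∀ s → col (strandAct σ s) ≡ not (col s))

-- slope true : axis y = x + c,  glide g·δ in direction (1,1)
-- slope false: axis y = c - x,  glide g·δ in direction (1,-1)
-- (c, g ∈ ℤ; these are exactly the grid-preserving glide-reflections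
--  with axis through cell centres and corners, glide a multiple of δ)
diagGlide : (slope : Bool) → (c g : ℤ) → Isometry
diagGlide true  c g = iso true false false (g - c) (g + c)
diagGlide false c g = iso true true  true  (c + g) (c - g)

-- the cell (i , j) has its centre on the axis
OnAxis : (slope : Bool) → ℤ → Cell → Set
OnAxis true  c (i , j) = j ≡ i + c
OnAxis false c (i , j) = i + j ≡ c - + 1

AxisRedundant : (Strand → Bool) → Bool → ℤ → Set
AxisRedundant col sl c = ∀ x → OnAxis sl c x → Redundant col x

AxisIrredundant : (Strand → Bool) → Bool → ℤ → Set
AxisIrredundant col sl c = ∀ x → OnAxis sl c x → ¬ Redundant col x

EvenZ : ℤ → Set
EvenZ g = parity g ≡ false

OddZ : ℤ → Set
OddZ g = parity g ≡ true

module Submission where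

-- The pattern P shows in every cell the colour of the strand uppermost
-- there, and a side-preserving symmetry σ of F carries the uppermost
-- strand of each cell x onto that of σ(x).  So if σ changes the colour of
-- every strand by one bit e, then P(σ x) = P(x) xor e: σ is a symmetry of
-- P, side-reversing exactly when e differs from the direction-swap bit.
-- Thin striping colours a strand by the parity of its index plus a phase,
-- and a diagonal glide with axis through the cell (0 , k) and glide g·δ
-- swaps directions and recolours every strand by
-- parity g xor [cell (0 , k) is irredundant]: 1 in the first case of the
-- corollary (side-preserving symmetry of P), 0 in the second.

open import Defs
open import Data.Bool using (Bool; true; false)
open import Data.Integer using (ℤ)
open import Data.Product using (_×_)
open import Data.Sum using (_⊎_)

open import Data.Bool using (not; _xor_; if_then_else_)
open import Data.Bool.Properties
  using (xor-identityʳ; not-distribˡ-xor; xor-∧-commutativeRing)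
open import Level using (0ℓ)
open import Data.Maybe using (Maybe; just; nothing)
open import Data.Nat using (zero; suc; _%_; _≡ᵇ_)
open import Data.Integer using (+_; -[1+_]; _+_; _-_; -_)
open import Data.Integer.Properties
  using (+-assoc; +-identityˡ; +-inverseʳ; ∣-i∣≡∣i∣)
open import Data.Product using (_,_)
open import Data.Sum using (inj₁; inj₂)
open import Relation.Nullary using (¬_; contradiction)
open import Relation.Binary.PropositionalEquality
  using (_≡_; refl; sym; trans; cong; cong₂; module ≡-Reasoning)
open import Tactic.RingSolver using (solve-∀)
open import Tactic.RingSolver.Core.AlmostCommutativeRing
  using (AlmostCommutativeRing; fromCommutativeRing)

boolRing : AlmostCommutativeRing 0ℓ 0ℓ
boolRing = fromCommutativeRing xor-∧-commutativeRing isFalse?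
  where
  isFalse? : ∀ x → Maybe (false ≡ x)
  isFalse? false = just refl
  isFalse? true  = nothing

parityℕ-suc : ∀ n → (suc n % 2 ≡ᵇ 1) ≡ not (n % 2 ≡ᵇ 1)
parityℕ-suc zero          = refl
parityℕ-suc (suc zero)    = refl
parityℕ-suc (suc (suc n)) = parityℕ-suc n

parity-suc : ∀ x → parity (+ 1 + x) ≡ not (parity x)
parity-suc (+ n)            = parityℕ-suc n
parity-suc -[1+ zero ]      = refl
parity-suc -[1+ suc n ]     = parityℕ-suc n

parity-+ℕ : ∀ n y → parity (+ n + y) ≡ parity (+ n) xor parity y
parity-+ℕ zero    y = cong parity (+-identityˡ y)
parity-+ℕ (suc n) y = begin
  parity (+ suc n + y)             ≡⟨ cong parity (+-assoc (+ 1) (+ n) y) ⟩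
  parity (+ 1 + (+ n + y))         ≡⟨ parity-suc (+ n + y) ⟩
  not (parity (+ n + y))           ≡⟨ cong not (parity-+ℕ n y) ⟩
  not (parity (+ n) xor parity y)  ≡⟨ not-distribˡ-xor (parity (+ n)) (parity y) ⟩
  not (parity (+ n)) xor parity y  ≡⟨ cong (_xor parity y) (sym (parity-suc (+ n))) ⟩
  parity (+ suc n) xor parity y    ∎
  where open ≡-Reasoning

-- Parity is additive: a homomorphism from (ℤ, +) to (Bool, xor).  A
-- negative summand -[1+ n ] is moved across as + suc n, of equal parity.
parity-+ : ∀ x y → parity (x + y) ≡ parity x xor parity y
parity-+ (+ n)      y = parity-+ℕ n y
parity-+ -[1+ n ]   y = begin
  parity z                       ≡⟨ cancel p (parity z) ⟩
  p xor (p xor parity z)         ≡⟨ cong (p xor_) (sym (parity-+ℕ (suc n) z)) ⟩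
  p xor parity (+ suc n + z)     ≡⟨ cong (λ w → p xor parity w) restore ⟩
  p xor parity y                 ∎
  where
  open ≡-Reasoning
  z : ℤ
  z = -[1+ n ] + y
  p : Bool
  p = parity (+ suc n)
  restore : + suc n + z ≡ y
  restore = begin
    + suc n + (-[1+ n ] + y)   ≡⟨ sym (+-assoc (+ suc n) -[1+ n ] y) ⟩
    (+ suc n + -[1+ n ]) + y   ≡⟨ cong (_+ y) (+-inverseʳ (+ suc n)) ⟩
    + 0 + y                    ≡⟨ +-identityˡ y ⟩
    y                          ∎
  cancel : ∀ q r → r ≡ q xor (q xor r)
  cancel = solve-∀ boolRing

parity-neg : ∀ x → parity (- x) ≡ parity x
parity-neg x = cong (λ n → (n % 2) ≡ᵇ 1) (∣-i∣≡∣i∣ x)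

parity-− : ∀ x y → parity (x - y) ≡ parity x xor parity y
parity-− x y = trans (parity-+ x (- y)) (cong (parity x xor_) (parity-neg y))

parity-coordAct : ∀ n t u → parity (coordAct n t u) ≡ parity u xor (parity t xor n)
parity-coordAct false t u = begin
  parity (u + t)                      ≡⟨ parity-+ u t ⟩
  parity u xor parity t               ≡⟨ cong (parity u xor_) (sym (xor-identityʳ (parity t))) ⟩
  parity u xor (parity t xor false)   ∎
  where open ≡-Reasoning
parity-coordAct true t u = begin
  parity ((t - + 1) - u)                 ≡⟨ parity-− (t - + 1) u ⟩
  parity (t - + 1) xor parity u          ≡⟨ cong (_xor parity u) (parity-− t (+ 1)) ⟩
  (parity t xor true) xor parity u       ≡⟨ rotate (parity t) (parity u) ⟩
  parity u xor (parity t xor true)       ∎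
  where
  open ≡-Reasoning
  rotate : ∀ p q → (p xor true) xor q ≡ q xor (p xor true)
  rotate = solve-∀ boolRing

uppermost : Design → Cell → Strand
uppermost D (i , j) = if D i j then warp i else weft j

pattern-uppermost : ∀ D col x → at (pattern' D col) x ≡ col (uppermost D x)
pattern-uppermost D col (i , j) with D i j
... | true  = refl
... | false = refl

uppermost-equivariant : ∀ D σ → InH1 D σ → ∀ x →
  uppermost D (cellAct σ x) ≡ strandAct σ (uppermost D x)
uppermost-equivariant D (iso false nx ny tx ty) isSym (i , j)
  with D (coordAct nx tx i) (coordAct ny ty j) | D i j | isSym (i , j)
... | true  | true  | refl = refl
... | false | false | refl = refl
uppermost-equivariant D (iso true nx ny tx ty) isSym (i , j)
  with D (coordAct nx tx j) (coordAct ny ty i) | D i j | isSym (i , j)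
... | false | true  | refl = refl
... | true  | false | refl = refl

pattern-symmetry : ∀ D col σ e → InH1 D σ →
  (∀ s → col (strandAct σ s) ≡ col s xor e) →
  IsSymmetry (pattern' D col) σ (Swaps σ xor e)
pattern-symmetry D col σ e isSym recolour x = begin
  at P (cellAct σ x)                          ≡⟨ pattern-uppermost D col (cellAct σ x) ⟩
  col (uppermost D (cellAct σ x))             ≡⟨ cong col (uppermost-equivariant D σ isSym x) ⟩
  col (strandAct σ (uppermost D x))           ≡⟨ recolour (uppermost D x) ⟩
  col (uppermost D x) xor e                   ≡⟨ cong (_xor e) (sym (pattern-uppermost D col x)) ⟩
  at P x xor e                                ≡⟨ insert (at P x) (Swaps σ) e ⟩
  (at P x xor Swaps σ) xor (Swaps σ xor e)    ∎
  where
  open ≡-Reasoning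
  P : Design
  P = pattern' D col
  insert : ∀ p q r → p xor r ≡ (p xor q) xor (q xor r)
  insert = solve-∀ boolRing

crossing : (Strand → Bool) → Cell → Bool
crossing col (i , j) = col (warp i) xor col (weft j)

redundant-crossing : ∀ col x → Redundant col x → crossing col x ≡ false
redundant-crossing col (i , j) same with col (warp i) | col (weft j)
redundant-crossing col (i , j) refl | true  | true  = refl
redundant-crossing col (i , j) refl | false | false = refl

irredundant-crossing : ∀ col x → ¬ Redundant col x → crossing col x ≡ true
irredundant-crossing col (i , j) differ with col (warp i) | col (weft j)
... | true  | false = refl
... | false | true  = refl
... | true  | true  = contradiction refl differ
... | false | false = contradiction refl differ

-- the row in which the diagonal axis (slope sl, offset c) meets column 0,
-- and the cell there, whose centre lies on the axis
axisRow : Bool → ℤ → ℤ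
axisRow true  c = c
axisRow false c = c - + 1

axisCell : Bool → ℤ → Cell
axisCell sl c = + 0 , axisRow sl c

axisCell-onAxis : ∀ sl c → OnAxis sl c (axisCell sl c)
axisCell-onAxis true  c = sym (+-identityˡ c)
axisCell-onAxis false c = +-identityˡ (c - + 1)

swap-recolours : ∀ a b nx ny tx ty d →
  parity tx xor nx ≡ d → parity ty xor ny ≡ d → ∀ s →
  thinStriping a b (strandAct (iso true nx ny tx ty) s)
    ≡ thinStriping a b s xor (d xor (a xor b))
swap-recolours a b nx ny tx ty d shiftˣ shiftʸ (warp i) = begin
  parity (coordAct ny ty i) xor b          ≡⟨ cong (_xor b) (parity-coordAct ny ty i) ⟩
  (parity i xor (parity ty xor ny)) xor b  ≡⟨ cong (λ e → (parity i xor e) xor b) shiftʸ ⟩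
  (parity i xor d) xor b                   ≡⟨ regroup (parity i) d a b ⟩
  (parity i xor a) xor (d xor (a xor b))   ∎
  where
  open ≡-Reasoning
  regroup : ∀ p q r s → (p xor q) xor s ≡ (p xor r) xor (q xor (r xor s))
  regroup = solve-∀ boolRing
swap-recolours a b nx ny tx ty d shiftˣ shiftʸ (weft j) = begin
  parity (coordAct nx tx j) xor a          ≡⟨ cong (_xor a) (parity-coordAct nx tx j) ⟩
  (parity j xor (parity tx xor nx)) xor a  ≡⟨ cong (λ e → (parity j xor e) xor a) shiftˣ ⟩
  (parity j xor d) xor a                   ≡⟨ regroup (parity j) d a b ⟩
  (parity j xor b) xor (d xor (a xor b))   ∎
  where
  open ≡-Reasoning
  regroup : ∀ p q r s → (p xor q) xor r ≡ (p xor s) xor (q xor (r xor s))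
  regroup = solve-∀ boolRing

diagGlide-recolours : ∀ a b sl c g s →
  thinStriping a b (strandAct (diagGlide sl c g) s)
    ≡ thinStriping a b s xor (parity g xor crossing (thinStriping a b) (axisCell sl c))
diagGlide-recolours a b sl c g s =
  trans (recolours sl) (cong (thinStriping a b s xor_) (shift-bit (parity g) (parity (axisRow sl c)) a b))
  where
  shift-bit : ∀ p q r s → (p xor q) xor (r xor s) ≡ p xor (r xor (q xor s))
  shift-bit = solve-∀ boolRing
  -- parity of c ± g, shifted once more by a reflection of both axes
  reflected : ∀ t → parity t ≡ parity c xor parity g →
              parity t xor true ≡ parity g xor parity (c - + 1)
  reflected t pt = begin
    parity t xor true                 ≡⟨ cong (_xor true) pt ⟩
    (parity c xor parity g) xor true  ≡⟨ swap (parity c) (parity g) ⟩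
    parity g xor (parity c xor true)  ≡⟨ cong (parity g xor_) (sym (parity-− c (+ 1))) ⟩
    parity g xor parity (c - + 1)     ∎
    where
    open ≡-Reasoning
    swap : ∀ p q → (p xor q) xor true ≡ q xor (p xor true)
    swap = solve-∀ boolRing
  recolours : ∀ sl → thinStriping a b (strandAct (diagGlide sl c g) s)
    ≡ thinStriping a b s xor ((parity g xor parity (axisRow sl c)) xor (a xor b))
  recolours true = swap-recolours a b false false (g - c) (g + c) _
    (trans (xor-identityʳ _) (parity-− g c)) (trans (xor-identityʳ _) (parity-+ g c)) s
  recolours false = swap-recolours a b true true (c + g) (c - g) _
    (reflected (c + g) (parity-+ c g)) (reflected (c - g) (parity-− c g)) s

diagGlide-patternSymmetry : ∀ F a b sl c g e → InH1 F (diagGlide sl c g) →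
  parity g xor crossing (thinStriping a b) (axisCell sl c) ≡ e →
  IsSymmetry (pattern' F (thinStriping a b)) (diagGlide sl c g) (not e)
diagGlide-patternSymmetry F a b true c g e isSym bit =
  pattern-symmetry F (thinStriping a b) (diagGlide true c g) e isSym
    (λ s → trans (diagGlide-recolours a b true c g s) (cong (thinStriping a b s xor_) bit))
diagGlide-patternSymmetry F a b false c g e isSym bit =
  pattern-symmetry F (thinStriping a b) (diagGlide false c g) e isSym
    (λ s → trans (diagGlide-recolours a b false c g s) (cong (thinStriping a b s xor_) bit))

colours-interchanged : ∀ col sl c g →
  (AxisIrredundant col sl c × EvenZ g) ⊎ (AxisRedundant col sl c × OddZ g) →
  parity g xor crossing col (axisCell sl c) ≡ true
colours-interchanged col sl c g (inj₁ (irredundant , even)) =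
  cong₂ _xor_ even (irredundant-crossing col (axisCell sl c) (irredundant _ (axisCell-onAxis sl c)))
colours-interchanged col sl c g (inj₂ (redundant , odd)) =
  cong₂ _xor_ odd (redundant-crossing col (axisCell sl c) (redundant _ (axisCell-onAxis sl c)))

colours-preserved : ∀ col sl c g →
  (AxisRedundant col sl c × EvenZ g) ⊎ (AxisIrredundant col sl c × OddZ g) →
  parity g xor crossing col (axisCell sl c) ≡ false
colours-preserved col sl c g (inj₁ (redundant , even)) =
  cong₂ _xor_ even (redundant-crossing col (axisCell sl c) (redundant _ (axisCell-onAxis sl c)))
colours-preserved col sl c g (inj₂ (irredundant , odd)) =
  cong₂ _xor_ odd (irredundant-crossing col (axisCell sl c) (irredundant _ (axisCell-onAxis sl c)))

corollary3p2 :
    (F : Design) → Periodic F → IsFabric F → OrderGreaterThan4 F →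
    (a b : Bool) → Perfect F (thinStriping a b) →
    H1GeneratedByGlides F → H1Transitive F →
    let col = thinStriping a b
        P = pattern' F col
    in
    ((sl : Bool) (c g : ℤ) →
       IsGlideReflection (diagGlide sl c g) → InH1 F (diagGlide sl c g) →
       (AxisIrredundant col sl c × EvenZ g) ⊎ (AxisRedundant col sl c × OddZ g) →
       IsGlideReflection (diagGlide sl c g) × IsSymmetry P (diagGlide sl c g) false)
    ×
    ((sl : Bool) (c g : ℤ) →
       IsGlideReflection (diagGlide sl c g) → InH1 F (diagGlide sl c g) →
       (AxisRedundant col sl c × EvenZ g) ⊎ (AxisIrredundant col sl c × OddZ g) →
       IsGlideReflection (diagGlide sl c g) × IsSymmetry P (diagGlide sl c g) true)
corollary3p2 F _ _ _ a b _ _ _ =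
  (λ sl c g glide isSym case →
     glide , diagGlide-patternSymmetry F a b sl c g true isSym
               (colours-interchanged (thinStriping a b) sl c g case)) ,
  (λ sl c g glide isSym case →
     glide , diagGlide-patternSymmetry F a b sl c g false isSym
               (colours-preserved (thinStriping a b) sl c g case))
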